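{- Let $f:\{0,1\}^n\to\{0,1\}$ be monotone and let $x\in\{0,1\}^n$. If $S\subseteq[n]$ is a minimal certificate for $f$ at $x$, then $|S|\le C(f)$.
   Context: A function $f:\{0,1\}^n\to\{0,1\}$ is monotone if $x\le y$ coordinatewise implies $f(x)\le f(y)$. For $x\in\{0,1\}^n$ and $S\subseteq[n]$, $x|_S$ denotes the restriction of $x$ to the coordinates in $S$. A set $S\subseteq[n]$ is a certificate for $f$ at $x$ if every $y$ with $y|_S=x|_S$ satisfies $f(y)=f(x)$. A certificate $S$ is minimal if for every $a\in S$, $S\setminus\{a\}$ is not a certificate for $f$ at $x$. $C(f,x)$ is the minimum size of a certificate for $f$ at $x$, and $C(f)=\max_{x}C(f,x)$. -}

module Defs where

open import Data.Nat using (ℕ; _≤_)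
open import Data.Bool using (Bool) renaming (_≤_ to _≤ᵇ_)
open import Data.Fin using (Fin)
open import Data.Fin.Subset using (Subset; _∈_; ∣_∣; _-_)
open import Data.Product using (Σ; _×_; ∃)
open import Relation.Binary.PropositionalEquality using (_≡_)
open import Relation.Nullary using (¬_)

-- points of the Boolean cube {0,1}^n  (false = 0, true = 1)
Cube : ℕ → Set
Cube n = Fin n → Bool

_≤ᶜ_ : ∀ {n} → Cube n → Cube n → Set
x ≤ᶜ y = ∀ i → x i ≤ᵇ y i

Monotone : ∀ {n} → (Cube n → Bool) → Set
Monotone f = ∀ x y → x ≤ᶜ y → f x ≤ᵇ f y

AgreeOn : ∀ {n} → Subset n → Cube n → Cube n → Set
AgreeOn S x y = ∀ i → i ∈ S → y i ≡ x i

IsCertificate : ∀ {n} → (Cube n → Bool) → Cube n → Subset n → Set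
IsCertificate f x S = ∀ y → AgreeOn S x y → f y ≡ f x

IsMinimalCertificate : ∀ {n} → (Cube n → Bool) → Cube n → Subset n → Set
IsMinimalCertificate f x S =
  IsCertificate f x S × (∀ a → a ∈ S → ¬ IsCertificate f x (S - a))

IsCertComplexityAt : ∀ {n} → (Cube n → Bool) → Cube n → ℕ → Set
IsCertComplexityAt f x m =
  (Σ _ λ S → IsCertificate f x S × ∣ S ∣ ≡ m) ×
  (∀ S → IsCertificate f x S → m ≤ ∣ S ∣)

IsCertComplexity : ∀ {n} → (Cube n → Bool) → ℕ → Set
IsCertComplexity f c =
  (Σ _ λ x → IsCertComplexityAt f x c) ×
  (∀ x m → IsCertComplexityAt f x m → m ≤ c)

{-# OPTIONS --safe #-}
module Submission where

-- Let b = f x and let z agree with x on S and equal ¬b elsewhere; then f z = b.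
-- Every certificate T for f at z contains S: if i ∈ S lay outside T, the point w
-- that agrees with z on T and equals ¬b elsewhere has f w = b, and any y agreeing
-- with x on S - i is at least as far towards b as w in every coordinate, so by
-- monotonicity f y = b, making S - i a certificate at x against minimality.
-- Hence C(f,z) = |S|, and |S| ≤ C(f).

open import Defs
open import Data.Nat using (ℕ; _≤_)
open import Data.Bool using (Bool; true; false; not) renaming (_≤_ to _≤ᵇ_)
open import Data.Bool.Properties using (≤-reflexive; ≤-antisym; ≤-minimum; ≤-maximum)
open import Data.Fin using (Fin)
open import Data.Fin.Subset using (Subset; ∣_∣; _∈_; _∉_; _⊆_; _-_)
open import Data.Fin.Subset.Properties using (_∈?_; x∈p∧x≢y⇒x∈p-y; p⊆q⇒∣p∣≤∣q∣)
open import Data.Product using (_,_; proj₁; proj₂)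
open import Data.Sum using (_⊎_; inj₁; inj₂)
open import Relation.Nullary using (Dec; yes; no; contradiction)
open import Relation.Binary.PropositionalEquality using (_≡_; refl; sym; trans; subst)

private
  variable
    n : ℕ

monotone-preserves-value : {f : Cube n → Bool} → Monotone f →
  ∀ b {u v} → (∀ j → u j ≡ v j ⊎ u j ≡ not b) → f u ≡ b → f v ≡ b
monotone-preserves-value {f = f} mon true {u} {v} u≈v fu =
  ≤-antisym (≤-maximum (f v)) (subst (_≤ᵇ f v) fu (mon u v u≤v))
  where
  u≤v : u ≤ᶜ v
  u≤v j with u≈v j
  ... | inj₁ uj≡vj = ≤-reflexive uj≡vj
  ... | inj₂ uj≡false rewrite uj≡false = ≤-minimum (v j)
monotone-preserves-value {f = f} mon false {u} {v} u≈v fu =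
  ≤-antisym (subst (f v ≤ᵇ_) fu (mon v u v≤u)) (≤-minimum (f v))
  where
  v≤u : v ≤ᶜ u
  v≤u j with u≈v j
  ... | inj₁ uj≡vj = ≤-reflexive (sym uj≡vj)
  ... | inj₂ uj≡true rewrite uj≡true = ≤-maximum (v j)

certificate-transport : {f : Cube n → Bool} {x z : Cube n} {S : Subset n} →
  IsCertificate f x S → AgreeOn S x z → IsCertificate f z S
certificate-transport certS z≈x y y≈z =
  trans (certS y (λ i i∈S → trans (y≈z i i∈S) (z≈x i i∈S))) (sym (certS _ z≈x))

fill : Subset n → Cube n → Bool → Cube n
fill S x d j with j ∈? S
... | yes _ = x j
... | no _ = d

fill-agrees : (S : Subset n) (x : Cube n) (d : Bool) → AgreeOn S x (fill S x d)
fill-agrees S x d j j∈S with j ∈? S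
... | yes _ = refl
... | no j∉S = contradiction j∈S j∉S

fill-outside : (S : Subset n) (x : Cube n) (d : Bool) {j : Fin n} →
  j ∉ S → fill S x d j ≡ d
fill-outside S x d {j} j∉S with j ∈? S
... | yes j∈S = contradiction j∈S j∉S
... | no _ = refl

module MinimalCertificate {f : Cube n → Bool} {x : Cube n} {S : Subset n}
  (mon : Monotone f) (minS : IsMinimalCertificate f x S) where

  z : Cube n
  z = fill S x (not (f x))

  f-z : f z ≡ f x
  f-z = proj₁ minS z (fill-agrees S x _)

  certificate-at-z : IsCertificate f z S
  certificate-at-z = certificate-transport (proj₁ minS) (fill-agrees S x _)

  S⊆certificate-at-z : ∀ T → IsCertificate f z T → S ⊆ T
  S⊆certificate-at-z T certT {i} i∈S with i ∈? T
  ... | yes i∈T = i∈T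
  ... | no i∉T = contradiction certS-i (proj₂ minS i i∈S)
    where
    w : Cube n
    w = fill T z (not (f x))

    w-towards : ∀ y → AgreeOn (S - i) x y → ∀ j → w j ≡ y j ⊎ w j ≡ not (f x)
    w-towards y y≈x j = by-membership (j ∈? T) (j ∈? S)
      where
      by-membership : Dec (j ∈ T) → Dec (j ∈ S) → w j ≡ y j ⊎ w j ≡ not (f x)
      by-membership (no j∉T) _ = inj₂ (fill-outside T z _ j∉T)
      by-membership (yes j∈T) (no j∉S) =
        inj₂ (trans (fill-agrees T z _ j j∈T) (fill-outside S x _ j∉S))
      by-membership (yes j∈T) (yes j∈S) =
        inj₁ (trans (fill-agrees T z _ j j∈T) (trans (fill-agrees S x _ j j∈S)
          (sym (y≈x j (x∈p∧x≢y⇒x∈p-y j∈S λ { refl → i∉T j∈T })))))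

    certS-i : IsCertificate f x (S - i)
    certS-i y y≈x = monotone-preserves-value mon (f x) (w-towards y y≈x)
      (trans (certT w (fill-agrees T z _)) f-z)

  complexity-at-z : IsCertComplexityAt f z ∣ S ∣
  complexity-at-z =
    (S , certificate-at-z , refl) ,
    λ T certT → p⊆q⇒∣p∣≤∣q∣ (S⊆certificate-at-z T certT)

lemma3p1 : ∀ {n} (f : Cube n → Bool) (x : Cube n) (S : Subset n) (c : ℕ) →
    Monotone f → IsMinimalCertificate f x S → IsCertComplexity f c → ∣ S ∣ ≤ c
lemma3p1 f x S c mon minS hc = proj₂ hc z ∣ S ∣ complexity-at-z
  where open MinimalCertificate mon minS
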